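{- Fix a base vertex $u_0\in X$ and $x,y\in X$; let $U=x\cap y$, $\ell=\dim(u_0\cap U)$ and $X'=\{z\in X:U\subseteq z\}$. If $z\in X'$ satisfies $f_x(z)=f_y(z)=1$, then $\partial(u_0,z)=d-\ell$.
   Context: $V$ is a finite-dimensional vector space over a finite field equipped with a non-degenerate form (alternating, Hermitian, or quadratic) of Witt index $d$; $X$ is the set of maximal totally isotropic subspaces of $V$ (each of dimension $d$). The dual polar graph on $X$ has $x\sim y$ iff $\dim(x\cap y)=d-1$; its path-length distance is $\partial(x,y)=d-\dim(x\cap y)$. For $w\in X$, $f_w:X\to\mathbb{R}$ is defined by $f_w(v)=1$ if $\partial(u_0,w)+\partial(w,v)=\partial(u_0,v)$ and $f_w(v)=0$ otherwise. -}

module Defs where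

open import Data.Nat using (ℕ; _≤_) renaming (_+_ to _+ℕ_)
open import Data.Fin using (Fin)
open import Data.Vec using (Vec; []; _∷_; map; zipWith; replicate)
open import Data.Vec.Relation.Unary.All using (All)
open import Data.Product using (Σ; ∃; _×_)
open import Relation.Binary.PropositionalEquality using (_≡_; _≢_)
open import Algebra.Structures using (IsCommutativeRing)
open import Function.Bundles using (_↔_)

record FiniteField : Set₁ where
  infixl 6 _+_
  infixl 7 _*_
  field
    F     : Set
    _+_   : F → F → F
    _*_   : F → F → F
    -_    : F → F
    0#    : F
    1#    : F
    isCommutativeRing : IsCommutativeRing _≡_ _+_ _*_ -_ 0# 1#
    0≢1   : 0# ≢ 1#
    inverse : ∀ a → a ≢ 0# → ∃ λ b → a * b ≡ 1#
    finite : Σ ℕ λ q → F ↔ Fin q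

module LinearAlgebra (K : FiniteField) (n : ℕ) where
  open FiniteField K

  V : Set
  V = Vec F n

  0ᵥ : V
  0ᵥ = replicate n 0#

  infixl 6 _+ᵥ_
  _+ᵥ_ : V → V → V
  _+ᵥ_ = zipWith _+_

  infixl 7 _·_
  _·_ : F → V → V
  a · v = map (a *_) v

  record Subspace : Set₁ where
    field
      mem     : V → Set
      0∈      : mem 0ᵥ
      +-closed : ∀ {u v} → mem u → mem v → mem (u +ᵥ v)
      ·-closed : ∀ a {v} → mem v → mem (a · v)
  open Subspace public

  _⊆_ : Subspace → Subspace → Set
  U ⊆ W = ∀ v → mem U v → mem W v

  _∩_ : Subspace → Subspace → Subspace
  U ∩ W = record
    { mem = λ v → mem U v × mem W v
    ; 0∈ = 0∈ U Data.Product., 0∈ W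
    ; +-closed = λ p q → +-closed U (Data.Product.proj₁ p) (Data.Product.proj₁ q)
                         Data.Product., +-closed W (Data.Product.proj₂ p) (Data.Product.proj₂ q)
    ; ·-closed = λ a p → ·-closed U a (Data.Product.proj₁ p) Data.Product., ·-closed W a (Data.Product.proj₂ p)
    }

  lincomb : ∀ {k} → Vec F k → Vec V k → V
  lincomb []       []       = 0ᵥ
  lincomb (c ∷ cs) (v ∷ vs) = c · v +ᵥ lincomb cs vs

  LinearlyIndependent : ∀ {k} → Vec V k → Set
  LinearlyIndependent {k} vs =
    ∀ (cs : Vec F k) → lincomb cs vs ≡ 0ᵥ → All (_≡ 0#) cs

  Spans : ∀ {k} → Vec V k → Subspace → Set
  Spans {k} vs W = ∀ v → mem W v → ∃ λ (cs : Vec F k) → lincomb cs vs ≡ v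

  HasDim : Subspace → ℕ → Set
  HasDim W k = ∃ λ (bs : Vec V k) →
    All (mem W) bs × LinearlyIndependent bs × Spans bs W

module Forms (K : FiniteField) (n : ℕ) where
  open FiniteField K
  open LinearAlgebra K n

  LinearLeft : (V → V → F) → Set
  LinearLeft B = ∀ a u u' v → B (a · u +ᵥ u') v ≡ a * B u v + B u' v

  SemilinearRight : (F → F) → (V → V → F) → Set
  SemilinearRight σ B = ∀ a u v v' → B u (a · v +ᵥ v') ≡ σ a * B u v + B u v'

  NonDegenerateB : (V → V → F) → Set
  NonDegenerateB B = ∀ v → (∀ u → B v u ≡ 0#) → v ≡ 0ᵥ

  record AlternatingForm : Set where
    field
      B          : V → V → F
      linearˡ    : LinearLeft B
      linearʳ    : SemilinearRight (λ a → a) B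
      alternating : ∀ v → B v v ≡ 0#
      nondegenerate : NonDegenerateB B

  record HermitianForm : Set where
    field
      σ          : F → F
      σ-+        : ∀ a b → σ (a + b) ≡ σ a + σ b
      σ-*        : ∀ a b → σ (a * b) ≡ σ a * σ b
      σ-1        : σ 1# ≡ 1#
      σ-invol    : ∀ a → σ (σ a) ≡ a
      σ-nontriv  : ∃ λ a → σ a ≢ a
      B          : V → V → F
      linearˡ    : LinearLeft B
      semilinearʳ : SemilinearRight σ B
      hermitian  : ∀ u v → B v u ≡ σ (B u v)
      nondegenerate : NonDegenerateB B

  record QuadraticForm : Set where
    field
      Q          : V → F
      homog      : ∀ a v → Q (a · v) ≡ a * a * Q v
    β : V → V → F
    β u v = Q (u +ᵥ v) + - (Q u) + - (Q v)
    field
      β-linearˡ  : LinearLeft β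
      β-linearʳ  : SemilinearRight (λ a → a) β
      nondegenerate : ∀ v → (∀ u → β v u ≡ 0#) → Q v ≡ 0# → v ≡ 0ᵥ

  data PolarForm : Set where
    alternating : AlternatingForm → PolarForm
    hermitian   : HermitianForm → PolarForm
    quadratic   : QuadraticForm → PolarForm

  TotallyIsotropic : PolarForm → Subspace → Set
  TotallyIsotropic (alternating f) W =
    ∀ u v → mem W u → mem W v → AlternatingForm.B f u v ≡ 0#
  TotallyIsotropic (hermitian f) W =
    ∀ u v → mem W u → mem W v → HermitianForm.B f u v ≡ 0#
  TotallyIsotropic (quadratic f) W =
    ∀ v → mem W v → QuadraticForm.Q f v ≡ 0#

  IsWittIndex : PolarForm → ℕ → Set₁
  IsWittIndex φ d =
    (∃ λ W → TotallyIsotropic φ W × HasDim W d) ×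
    (∀ W k → TotallyIsotropic φ W → HasDim W k → k ≤ d)

  -- elements of X: maximal totally isotropic subspaces
  record MaxTI (φ : PolarForm) : Set₁ where
    field
      space   : Subspace
      isTI    : TotallyIsotropic φ space
      maximal : ∀ W → TotallyIsotropic φ W → space ⊆ W → W ⊆ space
  open MaxTI public

  -- dual polar distance  ∂(x,y) = d - dim(x ∩ y), as a relation:
  -- Dist d x y m  iff  m + dim(x ∩ y) = d
  Dist : ∀ {φ} → ℕ → MaxTI φ → MaxTI φ → ℕ → Set
  Dist d x y m = ∃ λ k → HasDim (space x ∩ space y) k × m +ℕ k ≡ d

  -- f_w(v) = 1  iff  ∂(u₀,w) + ∂(w,v) = ∂(u₀,v)
  fw≡1 : ∀ {φ} → ℕ → (u₀ w v : MaxTI φ) → Set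
  fw≡1 d u₀ w v = ∃ λ a → ∃ λ b → ∃ λ c →
    Dist d u₀ w a × Dist d w v b × Dist d u₀ v c × a +ℕ b ≡ c

module Submission where

-- If w lies on a geodesic from u₀ to v, then u₀ ∩ v ⊆ w: the geodesic condition says
-- dim (u₀ ∩ w) + dim (w ∩ v) = d + dim (u₀ ∩ v), while (u₀ ∩ w) + (w ∩ v) lies in the
-- totally isotropic w and so has dimension at most d; by Grassmann's formula
-- dim (u₀ ∩ w ∩ v) ≥ dim (u₀ ∩ v), forcing u₀ ∩ v ⊆ w. Applied to x and y this gives
-- u₀ ∩ z ⊆ x ∩ y = U ⊆ z, hence u₀ ∩ z = u₀ ∩ U, of dimension ℓ.
--
-- The dimension theory is done by brute force over the finite field: spans are
-- decidable by enumerating coefficient vectors, and the Steinitz bound follows from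
-- the pigeonhole principle, since an injection F^m ↣ F^k forces q^m ≤ q^k.

open import Defs
open import Level using (0ℓ)
open import Data.Nat using (ℕ; zero; suc; z≤n; s≤s; _∸_; _^_; _≤_; _<_) renaming (_+_ to _+ℕ_)
import Data.Nat.Properties as ℕP
open import Data.Nat.Tactic.RingSolver using (solve-∀)
open import Data.Fin as Fin using (Fin)
open import Data.Fin.Properties using (any?; injective⇒≤; *↔×)
open import Data.Vec as Vec using (Vec; []; _∷_; map; zipWith; replicate; tabulate; _++_)
open import Data.Vec.Properties
  using (≡-dec; map-cong; map-∘; map-id; map-const; map-replicate;
         zipWith-assoc; zipWith-comm; zipWith-identityˡ; zipWith-identityʳ;
         zipWith-inverseˡ; zipWith-inverseʳ)
open import Data.Vec.Relation.Unary.All as All using (All; []; _∷_)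
open import Data.Vec.Relation.Unary.All.Properties using (++⁺; ++⁻; tabulate⁻)
open import Data.Product using (Σ; ∃; _×_; _,_; proj₁; proj₂; uncurry)
open import Data.Product.Function.NonDependent.Propositional using (_×-↔_)
open import Data.Empty using (⊥-elim)
open import Function using (_∘_)
open import Function.Bundles using (_↔_; _↣_; Inverse; Injection; mk↔ₛ′; mk↣)
open import Function.Definitions using (Injective)
open import Function.Properties.Inverse using (↔-sym; ↔-trans; ↔⇒↣)
open import Function.Properties.Injection using (↣-trans)
open import Relation.Nullary using (¬_; Dec; yes; no)
open import Relation.Nullary.Decidable using (map′; via-injection; _×-dec_)
open import Relation.Unary using (Decidable)
open import Relation.Binary.Definitions using (DecidableEquality)
open import Relation.Binary.PropositionalEquality
  using (_≡_; _≢_; refl; sym; trans; cong; cong₂; subst; isEquivalence; module ≡-Reasoning)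
open import Algebra.Bundles using (CommutativeRing; AbelianGroup)
import Algebra.Properties.Group as GroupProperties
import Algebra.Properties.CommutativeSemigroup as CommutativeSemigroupProperties
import Algebra.Properties.Ring as RingProperties

sum-of-complements : ∀ {d a b c a' b' c'} →
  a +ℕ a' ≡ d → b +ℕ b' ≡ d → c +ℕ c' ≡ d → a +ℕ b ≡ c → a' +ℕ b' ≡ d +ℕ c'
sum-of-complements {d} {a} {b} {c} {a'} {b'} {c'} a+a' b+b' c+c' a+b =
  ℕP.+-cancelʳ-≡ c (a' +ℕ b') (d +ℕ c') (begin
    (a' +ℕ b') +ℕ c         ≡⟨ cong ((a' +ℕ b') +ℕ_) (sym a+b) ⟩
    (a' +ℕ b') +ℕ (a +ℕ b)  ≡⟨ regroup a b a' b' ⟩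
    (a +ℕ a') +ℕ (b +ℕ b')  ≡⟨ cong₂ _+ℕ_ a+a' b+b' ⟩
    d +ℕ d                  ≡⟨ cong (d +ℕ_) (sym c+c') ⟩
    d +ℕ (c +ℕ c')          ≡⟨ shift d c c' ⟩
    (d +ℕ c') +ℕ c          ∎)
  where
    open ≡-Reasoning
    regroup : ∀ a b a' b' → (a' +ℕ b') +ℕ (a +ℕ b) ≡ (a +ℕ a') +ℕ (b +ℕ b')
    regroup = solve-∀
    shift : ∀ d c c' → d +ℕ (c +ℕ c') ≡ (d +ℕ c') +ℕ c
    shift = solve-∀

All≡⇒≡replicate : ∀ {A : Set} {k} {x : A} {xs : Vec A k} → All (_≡ x) xs → xs ≡ replicate k x
All≡⇒≡replicate []           = refl
All≡⇒≡replicate (refl ∷ xs≡) = cong (_ ∷_) (All≡⇒≡replicate xs≡)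

module Coordinates (K : FiniteField) where
  open FiniteField K

  ring : CommutativeRing 0ℓ 0ℓ
  ring = record { isCommutativeRing = isCommutativeRing }

  private
    module R = CommutativeRing ring

  x+-1*x≡0 : ∀ a → a + - 1# * a ≡ 0#
  x+-1*x≡0 a = trans (cong (a +_) (RingProperties.-1*x≈-x R.ring a)) (R.-‿inverseʳ a)

  -- negation is scaling by -1, so that subspaces are visibly closed under it
  +-abelianGroup : ℕ → AbelianGroup 0ℓ 0ℓ
  +-abelianGroup m = record
    { Carrier = Vec F m
    ; _≈_     = _≡_
    ; _∙_     = zipWith _+_
    ; ε       = replicate m 0#
    ; _⁻¹     = map (- 1# *_)
    ; isAbelianGroup = record
      { isGroup = record
        { isMonoid = record
          { isSemigroup = record
            { isMagma = record { isEquivalence = isEquivalence ; ∙-cong = cong₂ (zipWith _+_) }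
            ; assoc   = zipWith-assoc R.+-assoc
            }
          ; identity = zipWith-identityˡ R.+-identityˡ , zipWith-identityʳ R.+-identityʳ
          }
        ; inverse = zipWith-inverseˡ (λ a → trans (R.+-comm _ a) (x+-1*x≡0 a))
                  , zipWith-inverseʳ x+-1*x≡0
        ; ⁻¹-cong = cong (map (- 1# *_))
        }
      ; comm = zipWith-comm R.+-comm
      }
    }

  ≡-from-difference : ∀ {m} (u v : Vec F m) →
    All (_≡ 0#) (zipWith _+_ u (map (- 1# *_) v)) → u ≡ v
  ≡-from-difference {m} u v u-v≡0 =
    GroupProperties.x∙y⁻¹≈ε⇒x≈y (AbelianGroup.group (+-abelianGroup m)) u v
      (All≡⇒≡replicate u-v≡0)

  map-*-distrib-zipWith : ∀ {m} a (u v : Vec F m) →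
    map (a *_) (zipWith _+_ u v) ≡ zipWith _+_ (map (a *_) u) (map (a *_) v)
  map-*-distrib-zipWith a []      []      = refl
  map-*-distrib-zipWith a (b ∷ u) (c ∷ v) =
    cong₂ _∷_ (R.distribˡ a b c) (map-*-distrib-zipWith a u v)

  map-+-distrib-zipWith : ∀ {m} a b (v : Vec F m) →
    map ((a + b) *_) v ≡ zipWith _+_ (map (a *_) v) (map (b *_) v)
  map-+-distrib-zipWith a b []      = refl
  map-+-distrib-zipWith a b (c ∷ v) = cong₂ _∷_ (R.distribʳ c a b) (map-+-distrib-zipWith a b v)

module Enumeration (K : FiniteField) where
  open FiniteField K

  q : ℕ
  q = proj₁ finite

  F↔Fin : F ↔ Fin q
  F↔Fin = proj₂ finite

  _≟F_ : DecidableEquality F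
  _≟F_ = via-injection (↔⇒↣ F↔Fin) Fin._≟_

  1<q : 1 < q
  1<q = distinct⇒1< (0≢1 ∘ Injection.injective (↔⇒↣ F↔Fin))
    where
      distinct⇒1< : ∀ {m} {i j : Fin m} → i ≢ j → 1 < m
      distinct⇒1< {suc zero}    {Fin.zero} {Fin.zero} i≢j = ⊥-elim (i≢j refl)
      distinct⇒1< {suc (suc m)} _ = s≤s (s≤s z≤n)

  Vec↔Fin : ∀ k → Vec F k ↔ Fin (q ^ k)
  Vec↔Fin zero    =
    mk↔ₛ′ (λ _ → Fin.zero) (λ _ → []) (λ { Fin.zero → refl ; (Fin.suc ()) }) (λ { [] → refl })
  Vec↔Fin (suc k) = ↔-trans ∷↔× (↔-trans (F↔Fin ×-↔ Vec↔Fin k) (↔-sym *↔×))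
    where
      ∷↔× : Vec F (suc k) ↔ (F × Vec F k)
      ∷↔× = mk↔ₛ′ Vec.uncons (uncurry _∷_) (λ _ → refl) (λ { (a ∷ v) → refl })

  every : ∀ {k} → Vec (Vec F k) (q ^ k)
  every {k} = tabulate (Inverse.from (Vec↔Fin k))

  All-every⇒∀ : ∀ {k} {P : Vec F k → Set} → All P every → ∀ v → P v
  All-every⇒∀ {k} {P} all v =
    subst P (Inverse.strictlyInverseʳ (Vec↔Fin k) v) (tabulate⁻ all (Inverse.to (Vec↔Fin k) v))

  ∃-Vec? : ∀ {k} {P : Vec F k → Set} → Decidable P → Dec (∃ P)
  ∃-Vec? {k} {P} P? = map′
    (λ (j , Pj) → Inverse.from (Vec↔Fin k) j , Pj)
    (λ (v , Pv) → Inverse.to (Vec↔Fin k) v ,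
                  subst P (sym (Inverse.strictlyInverseʳ (Vec↔Fin k) v)) Pv)
    (any? (P? ∘ Inverse.from (Vec↔Fin k)))

  ↣⇒≤ : ∀ {m k} → Vec F m ↣ Vec F k → m ≤ k
  ↣⇒≤ {m} {k} m↣k = ℕP.≮⇒≥ λ k<m →
    ℕP.<⇒≱ (ℕP.^-monoʳ-< q 1<q k<m) (injective⇒≤ (Injection.injective Fin↣Fin))
    where
      Fin↣Fin : Fin (q ^ m) ↣ Fin (q ^ k)
      Fin↣Fin = ↣-trans (↔⇒↣ (↔-sym (Vec↔Fin m))) (↣-trans m↣k (↔⇒↣ (Vec↔Fin k)))

module Span (K : FiniteField) (n : ℕ) where
  open FiniteField K
  open LinearAlgebra K n
  open Coordinates K
  open Enumeration K

  private
    module R  = CommutativeRing ring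
    module +ᵥ = AbelianGroup (+-abelianGroup n)
    open GroupProperties +ᵥ.group using (inverseˡ-unique)
    open ≡-Reasoning

  +ᵥ-interchange : ∀ t u v w → (t +ᵥ u) +ᵥ (v +ᵥ w) ≡ (t +ᵥ v) +ᵥ (u +ᵥ w)
  +ᵥ-interchange = CommutativeSemigroupProperties.interchange +ᵥ.commutativeSemigroup

  ·-assoc : ∀ a b v → (a * b) · v ≡ a · (b · v)
  ·-assoc a b v = trans (map-cong (R.*-assoc a b) v) (map-∘ (a *_) (b *_) v)

  ·-identityˡ : ∀ v → 1# · v ≡ v
  ·-identityˡ v = trans (map-cong R.*-identityˡ v) (map-id v)

  ·-zeroˡ : ∀ v → 0# · v ≡ 0ᵥ
  ·-zeroˡ v = trans (map-cong R.zeroˡ v) (map-const v 0#)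

  ·-zeroʳ : ∀ a → a · 0ᵥ ≡ 0ᵥ
  ·-zeroʳ a = trans (map-replicate (a *_) 0# n) (cong (replicate n) (R.zeroʳ a))

  lincomb-replicate-0 : ∀ {k} (vs : Vec V k) → lincomb (replicate k 0#) vs ≡ 0ᵥ
  lincomb-replicate-0 []       = refl
  lincomb-replicate-0 (v ∷ vs) =
    trans (cong₂ _+ᵥ_ (·-zeroˡ v) (lincomb-replicate-0 vs)) (+ᵥ.identityˡ 0ᵥ)

  lincomb-zeros : ∀ {k} {cs : Vec F k} (vs : Vec V k) → All (_≡ 0#) cs → lincomb cs vs ≡ 0ᵥ
  lincomb-zeros vs cs≡0 =
    trans (cong (λ cs → lincomb cs vs) (All≡⇒≡replicate cs≡0)) (lincomb-replicate-0 vs)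

  lincomb-+ : ∀ {k} (cs ds : Vec F k) (vs : Vec V k) →
    lincomb (zipWith _+_ cs ds) vs ≡ lincomb cs vs +ᵥ lincomb ds vs
  lincomb-+ []       []       []       = sym (+ᵥ.identityˡ 0ᵥ)
  lincomb-+ (c ∷ cs) (d ∷ ds) (v ∷ vs) = begin
    (c + d) · v +ᵥ lincomb (zipWith _+_ cs ds) vs
      ≡⟨ cong₂ _+ᵥ_ (map-+-distrib-zipWith c d v) (lincomb-+ cs ds vs) ⟩
    (c · v +ᵥ d · v) +ᵥ (lincomb cs vs +ᵥ lincomb ds vs)
      ≡⟨ +ᵥ-interchange _ _ _ _ ⟩
    (c · v +ᵥ lincomb cs vs) +ᵥ (d · v +ᵥ lincomb ds vs) ∎

  lincomb-· : ∀ {k} a (cs : Vec F k) (vs : Vec V k) → lincomb (map (a *_) cs) vs ≡ a · lincomb cs vs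
  lincomb-· a []       []       = sym (·-zeroʳ a)
  lincomb-· a (c ∷ cs) (v ∷ vs) =
    trans (cong₂ _+ᵥ_ (·-assoc a c v) (lincomb-· a cs vs)) (sym (map-*-distrib-zipWith a _ _))

  lincomb-++ : ∀ {k l} (cs : Vec F k) (ds : Vec F l) (vs : Vec V k) (ws : Vec V l) →
    lincomb (cs ++ ds) (vs ++ ws) ≡ lincomb cs vs +ᵥ lincomb ds ws
  lincomb-++ []       ds []       ws = sym (+ᵥ.identityˡ _)
  lincomb-++ (c ∷ cs) ds (v ∷ vs) ws =
    trans (cong (c · v +ᵥ_) (lincomb-++ cs ds vs ws)) (sym (+ᵥ.assoc _ _ _))

  InSpan : ∀ {k} → Vec V k → V → Set
  InSpan {k} ws v = ∃ λ (cs : Vec F k) → lincomb cs ws ≡ v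

  span : ∀ {k} → Vec V k → Subspace
  span {k} ws = record
    { mem      = InSpan ws
    ; 0∈       = replicate k 0# , lincomb-replicate-0 ws
    ; +-closed = λ { (cs , refl) (ds , refl) → zipWith _+_ cs ds , lincomb-+ cs ds ws }
    ; ·-closed = λ { a (cs , refl) → map (a *_) cs , lincomb-· a cs ws }
    }

  span⊆ : ∀ (W : Subspace) {k} {ws : Vec V k} → All (mem W) ws → span ws ⊆ W
  span⊆ W []         _ ([] , refl)     = 0∈ W
  span⊆ W (w∈ ∷ ws∈) _ (c ∷ cs , refl) =
    +-closed W (·-closed W c w∈) (span⊆ W ws∈ _ (cs , refl))

  InSpan-∷ : ∀ {k} {ws : Vec V k} w {v} → InSpan ws v → InSpan (w ∷ ws) v
  InSpan-∷ w (cs , refl) = 0# ∷ cs , trans (cong (_+ᵥ _) (·-zeroˡ w)) (+ᵥ.identityˡ _)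

  InSpan-head : ∀ {k} w (ws : Vec V k) → InSpan (w ∷ ws) w
  InSpan-head {k} w ws = 1# ∷ replicate k 0# ,
    trans (cong₂ _+ᵥ_ (·-identityˡ w) (lincomb-replicate-0 ws)) (+ᵥ.identityʳ w)

  InSpan-self : ∀ {k} (ws : Vec V k) → All (InSpan ws) ws
  InSpan-self []       = []
  InSpan-self (w ∷ ws) = InSpan-head w ws ∷ All.map (InSpan-∷ w) (InSpan-self ws)

  InSpan? : ∀ {k} (ws : Vec V k) → Decidable (InSpan ws)
  InSpan? ws v = ∃-Vec? (λ cs → ≡-dec _≟F_ (lincomb cs ws) v)

  LI-[] : LinearlyIndependent []
  LI-[] [] _ = []

  lincomb-injective : ∀ {k} {vs : Vec V k} → LinearlyIndependent vs →
    ∀ cs ds → lincomb cs vs ≡ lincomb ds vs → cs ≡ ds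
  lincomb-injective {vs = vs} li cs ds e = ≡-from-difference cs ds (li _ (begin
    lincomb (zipWith _+_ cs (map (- 1# *_) ds)) vs ≡⟨ lincomb-+ cs _ vs ⟩
    lincomb cs vs +ᵥ lincomb (map (- 1# *_) ds) vs ≡⟨ cong₂ _+ᵥ_ e (lincomb-· (- 1#) ds vs) ⟩
    lincomb ds vs +ᵥ (- 1#) · lincomb ds vs        ≡⟨ +ᵥ.inverseʳ _ ⟩
    0ᵥ                                             ∎))

  LI-∷ : ∀ {k} {ι : Vec V k} → LinearlyIndependent ι →
    ∀ {v} → ¬ InSpan ι v → LinearlyIndependent (v ∷ ι)
  LI-∷ {ι = ι} li {v} v∉ι (c ∷ cs) e with c ≟F 0#
  ... | yes refl =
    refl ∷ li cs (trans (sym (+ᵥ.identityˡ _)) (trans (cong (_+ᵥ _) (sym (·-zeroˡ v))) e))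
  ... | no c≢0   = ⊥-elim (v∉ι (map ((b * - 1#) *_) cs , (begin
    lincomb (map ((b * - 1#) *_) cs) ι ≡⟨ lincomb-· _ cs ι ⟩
    (b * - 1#) · lincomb cs ι          ≡⟨ ·-assoc b (- 1#) _ ⟩
    b · ((- 1#) · lincomb cs ι)        ≡⟨ cong (b ·_) (sym (inverseˡ-unique _ _ e)) ⟩
    b · (c · v)                        ≡⟨ sym (·-assoc b c v) ⟩
    (b * c) · v                        ≡⟨ cong (_· v) (trans (R.*-comm b c) c*b≡1) ⟩
    1# · v                             ≡⟨ ·-identityˡ v ⟩
    v                                  ∎)))
    where
      b = proj₁ (inverse c c≢0)
      c*b≡1 = proj₂ (inverse c c≢0)

  steinitz : ∀ {m k} {vs : Vec V m} {ws : Vec V k} →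
    LinearlyIndependent vs → All (InSpan ws) vs → m ≤ k
  steinitz {m} {k} {vs} {ws} li vs⊆ws = ↣⇒≤ (mk↣ {to = coordinates} coordinates-injective)
    where
      coordinates : Vec F m → Vec F k
      coordinates cs = proj₁ (span⊆ (span ws) vs⊆ws _ (cs , refl))
      coordinates-correct : ∀ cs → lincomb (coordinates cs) ws ≡ lincomb cs vs
      coordinates-correct cs = proj₂ (span⊆ (span ws) vs⊆ws _ (cs , refl))
      coordinates-injective : Injective _≡_ _≡_ coordinates
      coordinates-injective {cs} {ds} e = lincomb-injective li cs ds (begin
        lincomb cs vs                ≡⟨ sym (coordinates-correct cs) ⟩
        lincomb (coordinates cs) ws  ≡⟨ cong (λ es → lincomb es ws) e ⟩
        lincomb (coordinates ds) ws  ≡⟨ coordinates-correct ds ⟩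
        lincomb ds vs                ∎)

  long-independent⇒spans : ∀ {c i} {γ : Vec V c} {ι : Vec V i} →
    LinearlyIndependent ι → All (InSpan γ) ι → c ≤ i → span γ ⊆ span ι
  long-independent⇒spans {ι = ι} li ι⊆γ c≤i v v∈γ with InSpan? ι v
  ... | yes v∈ι = v∈ι
  ... | no  v∉ι = ⊥-elim (ℕP.<⇒≱ (steinitz (LI-∷ li v∉ι) (v∈γ ∷ ι⊆γ)) c≤i)

  record Extension (P : V → Set) {i} (ι : Vec V i) {N} (candidates : Vec V N) : Set where
    field
      {size}      : ℕ
      new         : Vec V size
      independent : LinearlyIndependent (new ++ ι)
      new⊆P       : All P new
      covers      : All (λ w → P w → InSpan (new ++ ι) w) candidates

  open Extension public

  also-covers : ∀ {P i} {ι : Vec V i} {N} {ws : Vec V N} {w} (e : Extension P ι ws) →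
    (P w → InSpan (new e ++ ι) w) → Extension P ι (w ∷ ws)
  also-covers e w-covered = record
    { new = new e ; independent = independent e ; new⊆P = new⊆P e ; covers = w-covered ∷ covers e }

  extend : (P : V → Set) → Decidable P → ∀ {i} {ι : Vec V i} → LinearlyIndependent ι →
    ∀ {N} (candidates : Vec V N) → Extension P ι candidates
  extend P P? li [] = record { new = [] ; independent = li ; new⊆P = [] ; covers = [] }
  extend P P? {ι = ι} li (w ∷ ws) with extend P P? li ws
  ... | e with P? w | InSpan? (new e ++ ι) w
  ... | no ¬Pw | _      = also-covers e (λ Pw → ⊥-elim (¬Pw Pw))
  ... | yes _  | yes w∈ = also-covers e (λ _ → w∈)
  ... | yes Pw | no  w∉ = record
    { new         = w ∷ new e
    ; independent = LI-∷ (independent e) w∉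
    ; new⊆P       = Pw ∷ new⊆P e
    ; covers      = (λ _ → InSpan-head w _)
                  ∷ All.map (λ P⇒∈ Pu → InSpan-∷ w (P⇒∈ Pu)) (covers e)
    }

  P⊆span : ∀ {P i} {ι : Vec V i} (e : Extension P ι every) → ∀ v → P v → InSpan (new e ++ ι) v
  P⊆span e = All-every⇒∀ (covers e)

  meet-basis : ∀ {a b} (α : Vec V a) (β : Vec V b) →
    Extension (λ w → InSpan α w × InSpan β w) [] every
  meet-basis α β = extend _ (λ w → InSpan? α w ×-dec InSpan? β w) LI-[] every

  LI-++-complements : ∀ {a b i p r} {A : Vec V a} {B : Vec V b} {ι : Vec V i}
    {α : Vec V p} {β : Vec V r} →
    LinearlyIndependent (α ++ ι) → LinearlyIndependent (β ++ ι) →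
    All (InSpan A) (α ++ ι) → All (InSpan B) β →
    (∀ v → InSpan A v → InSpan B v → InSpan ι v) →
    LinearlyIndependent (β ++ α ++ ι)
  LI-++-complements {r = r} {A} {B} {ι} {α} {β} liα liβ α⊆A β⊆B A∩B⊆ι cs e
    with Vec.splitAt r cs
  ... | t , s , refl = ++⁺ t≡0 (liα s S≡0)
    where
      T = lincomb t β
      S = lincomb s (α ++ ι)
      T+S≡0 : T +ᵥ S ≡ 0ᵥ
      T+S≡0 = trans (sym (lincomb-++ t s β (α ++ ι))) e
      T∈A : InSpan A T
      T∈A = subst (InSpan A) (sym (inverseˡ-unique T S T+S≡0))
              (·-closed (span A) (- 1#) (span⊆ (span A) α⊆A S (s , refl)))
      t≡0 : All (_≡ 0#) t
      t≡0 with A∩B⊆ι T T∈A (span⊆ (span B) β⊆B T (t , refl))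
      ... | u , u≡T = proj₁ (++⁻ t (liβ (t ++ map (- 1# *_) u) (begin
        lincomb (t ++ map (- 1# *_) u) (β ++ ι) ≡⟨ lincomb-++ t _ β ι ⟩
        T +ᵥ lincomb (map (- 1# *_) u) ι       ≡⟨ cong (T +ᵥ_) (lincomb-· (- 1#) u ι) ⟩
        T +ᵥ (- 1#) · lincomb u ι              ≡⟨ cong (λ w → T +ᵥ (- 1#) · w) u≡T ⟩
        T +ᵥ (- 1#) · T                        ≡⟨ +ᵥ.inverseʳ T ⟩
        0ᵥ                                     ∎)))
      S≡0 : S ≡ 0ᵥ
      S≡0 = trans (sym (+ᵥ.identityˡ S)) (trans (cong (_+ᵥ S) (sym (lincomb-zeros β t≡0))) T+S≡0)

  grassmann : ∀ (W : Subspace) {a b} {α : Vec V a} {β : Vec V b} →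
    All (mem W) α → All (mem W) β → LinearlyIndependent α → LinearlyIndependent β →
    ∀ {i} {ι : Vec V i} → LinearlyIndependent ι → All (λ v → InSpan α v × InSpan β v) ι →
    (∀ v → InSpan α v → InSpan β v → InSpan ι v) →
    Σ ℕ λ m → Σ (Vec V m) λ E → LinearlyIndependent E × All (mem W) E × a +ℕ b ≤ m +ℕ i
  grassmann W {a} {b} {α} {β} α⊆W β⊆W liα liβ {i} {ι} liι ι⊆α∩β α∩β⊆ι =
    r +ℕ (p +ℕ i) , new eβ ++ new eα ++ ι ,
    LI-++-complements (independent eα) (independent eβ) α-part (new⊆P eβ) α∩β⊆ι ,
    ++⁺ (All.map (span⊆ W β⊆W _) (new⊆P eβ)) (All.map (span⊆ W α⊆W _) α-part) ,
    ℕP.≤-trans (ℕP.+-mono-≤ a≤p+i b≤r+i) (ℕP.≤-reflexive (regroup p r i))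
    where
      eα = extend (InSpan α) (InSpan? α) liι every
      eβ = extend (InSpan β) (InSpan? β) liι every
      p = size eα
      r = size eβ
      α-part : All (InSpan α) (new eα ++ ι)
      α-part = ++⁺ (new⊆P eα) (All.map proj₁ ι⊆α∩β)
      a≤p+i : a ≤ p +ℕ i
      a≤p+i = steinitz liα (All.map (λ {v} → P⊆span eα v) (InSpan-self α))
      b≤r+i : b ≤ r +ℕ i
      b≤r+i = steinitz liβ (All.map (λ {v} → P⊆span eβ v) (InSpan-self β))
      regroup : ∀ p r i → (p +ℕ i) +ℕ (r +ℕ i) ≡ (r +ℕ (p +ℕ i)) +ℕ i
      regroup = solve-∀

module Polar (K : FiniteField) (n : ℕ) where
  open LinearAlgebra K n
  open Forms K n
  open Span K n
  open Enumeration K using (every)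

  TI-mono : ∀ φ {W X : Subspace} → W ⊆ X → TotallyIsotropic φ X → TotallyIsotropic φ W
  TI-mono (alternating _) W⊆X X-TI u v u∈W v∈W = X-TI u v (W⊆X u u∈W) (W⊆X v v∈W)
  TI-mono (hermitian _)   W⊆X X-TI u v u∈W v∈W = X-TI u v (W⊆X u u∈W) (W⊆X v v∈W)
  TI-mono (quadratic _)   W⊆X X-TI v v∈W       = X-TI v (W⊆X v v∈W)

  LI-in-TI⇒≤ : ∀ {φ d} → IsWittIndex φ d → ∀ W → TotallyIsotropic φ W →
    ∀ {m} {E : Vec V m} → LinearlyIndependent E → All (mem W) E → m ≤ d
  LI-in-TI⇒≤ {φ} witt W W-TI {E = E} li E⊆W =
    proj₂ witt (span E) _ (TI-mono φ (span⊆ W E⊆W) W-TI)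
      (E , InSpan-self E , li , λ _ v∈E → v∈E)

  geodesic⇒∩⊆ : ∀ {φ d} → IsWittIndex φ d → (u₀ w v : MaxTI φ) →
    fw≡1 d u₀ w v → (space u₀ ∩ space v) ⊆ space w
  geodesic⇒∩⊆ {d = d} witt u₀ w v
    ( a , b , _
    , (a' , (α , α⊆u₀∩w , liα , _) , a+a')
    , (b' , (β , β⊆w∩v , liβ , _) , b+b')
    , (c' , (γ , _ , _ , γ-spans) , c+c')
    , a+b) t t∈u₀∩v =
    span⊆ (space w) J⊆w t (long-independent⇒spans liJ J⊆γ c'≤i t (γ-spans t t∈u₀∩v))
    where
      M : Extension (λ t → InSpan α t × InSpan β t) [] every
      M = meet-basis α β
      i : ℕ
      i = size M +ℕ 0
      J : Vec V i
      J = new M ++ []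
      liJ : LinearlyIndependent J
      liJ = independent M
      J⊆α∩β : All (λ t → InSpan α t × InSpan β t) J
      J⊆α∩β = ++⁺ (new⊆P M) []
      α⊆w : All (mem (space w)) α
      α⊆w = All.map proj₂ α⊆u₀∩w
      β⊆w : All (mem (space w)) β
      β⊆w = All.map proj₁ β⊆w∩v
      J⊆w : All (mem (space w)) J
      J⊆w = All.map (λ (t∈α , _) → span⊆ (space w) α⊆w _ t∈α) J⊆α∩β
      J⊆γ : All (InSpan γ) J
      J⊆γ = All.map (λ (t∈α , t∈β) → γ-spans _
              (proj₁ (span⊆ (space u₀ ∩ space w) α⊆u₀∩w _ t∈α) ,
               proj₂ (span⊆ (space w ∩ space v) β⊆w∩v _ t∈β))) J⊆α∩β
      c'≤i : c' ≤ i
      c'≤i with grassmann (space w) α⊆w β⊆w liα liβ liJ J⊆α∩β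
                  (λ t t∈α t∈β → P⊆span M t (t∈α , t∈β))
      ... | m , E , liE , E⊆w , a'+b'≤m+i = ℕP.+-cancelˡ-≤ d c' i (begin
        d +ℕ c'  ≡⟨ sum-of-complements {a = a} {b} a+a' b+b' c+c' a+b ⟨
        a' +ℕ b' ≤⟨ a'+b'≤m+i ⟩
        m +ℕ i   ≤⟨ ℕP.+-monoˡ-≤ i (LI-in-TI⇒≤ witt (space w) (isTI w) liE E⊆w) ⟩
        d +ℕ i   ∎)
        where open ℕP.≤-Reasoning

lemmaA3 : (K : FiniteField) (n : ℕ) →
          let open LinearAlgebra K n in
          let open Forms K n in
          (φ : PolarForm) (d : ℕ) → IsWittIndex φ d →
          (u₀ x y : MaxTI φ) (ℓ : ℕ) →
          HasDim (space u₀ ∩ (space x ∩ space y)) ℓ →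
          (z : MaxTI φ) → (space x ∩ space y) ⊆ space z →
          fw≡1 d u₀ x z → fw≡1 d u₀ y z →
          Dist d u₀ z (d ∸ ℓ)
lemmaA3 K n φ d witt u₀ x y ℓ (bs , bs⊆u₀∩U , li , bs-spans) z U⊆z fx fy =
  ℓ , (bs , bs⊆u₀∩z , li , bs-spans-u₀∩z) , ℕP.m∸n+n≡m ℓ≤d
  where
    open LinearAlgebra K n
    open Forms K n
    open Polar K n
    u₀∩z⊆U : (space u₀ ∩ space z) ⊆ (space x ∩ space y)
    u₀∩z⊆U t t∈ = geodesic⇒∩⊆ witt u₀ x z fx t t∈ , geodesic⇒∩⊆ witt u₀ y z fy t t∈
    bs⊆u₀∩z : All (mem (space u₀ ∩ space z)) bs
    bs⊆u₀∩z = All.map (λ (t∈u₀ , t∈U) → t∈u₀ , U⊆z _ t∈U) bs⊆u₀∩U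
    bs-spans-u₀∩z : Spans bs (space u₀ ∩ space z)
    bs-spans-u₀∩z t t∈@(t∈u₀ , _) = bs-spans t (t∈u₀ , u₀∩z⊆U t t∈)
    ℓ≤d : ℓ ≤ d
    ℓ≤d = LI-in-TI⇒≤ witt (space u₀) (isTI u₀) li (All.map proj₁ bs⊆u₀∩U)
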